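{- Let $t$ be a term of PPC_dB (well-formed, so that $\mathcal U(t)$ is defined) and let $s$ be a term of PPC. Then $\mathcal T(\mathcal U(t))=t$ and $\mathcal U(\mathcal T(s))=_\alpha s$.
   Context: **PPC.** Fix a countably infinite set of symbols. PPC terms are $t::=x\mid\hat x\mid t\,t\mid\lambda_\theta p.s$, where $\theta$ is a list of symbols. In $\lambda_\theta p.s$, $\theta$ binds the matchables $\hat x$ ($x\in\theta$) in $p$ and the variables $x$ ($x\in\theta$) in $s$. Free variables and free matchables: $fv(x)=\{x\}$, $fv(\hat x)=\emptyset$, $fm(x)=\emptyset$, $fm(\hat x)=\{x\}$; both are unions on applications; $fv(\lambda_\theta p.s)=fv(p)\cup(fv(s)\setminus\theta)$ and $fm(\lambda_\theta p.s)=(fm(p)\setminus\theta)\cup fm(s)$. $=_\alpha$ denotes $\alpha$-equivalence. **PPC_dB.** PPC_dB terms are $t::=\mathsf v_{i,j}\mid\mathsf m_{i,j}\mid t\,t\mid\lambda_np.s$, with $i,j\ge1$ and $n\in\mathbb N$ (variable and matchable bidimensional indices, with primary index $i$ and secondary index $j$). For a set $S$ of pairs, $S-1$ subtracts $1$ from each primary index and drops the non-positive ones. Free indices: $fv(\mathsf v_{i,j})=\{(i,j)\}$ and $fm(\mathsf m_{i,j})=\{(i,j)\}$ (empty in the other two cases); both are unions on applications; $fv(\lambda_np.s)=fv(p)\cup(fv(s)-1)$ and $fm(\lambda_np.s)=(fm(p)-1)\cup fm(s)$. A term is well-formed if every free index has secondary index $1$, and for every subterm $\lambda_np.s$ all pairs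 $(1,j)\in fm(p)\cup fv(s)$ satisfy $j\le n$. Equality of PPC_dB terms is modulo permutation of the secondary indices bound by a same abstraction. **Translations.** For lists of lists of symbols $V,M$: $V_{ij}$ is the $j$-th element of the $i$-th list, $++$ is concatenation, and for a list $\theta$ of symbols $\theta++V$ means $[\theta]++V$. Forward translation $\mathcal T_{V,M}$ (defined when $fv(t)\subseteq\bigcup V$ and $fm(t)\subseteq\bigcup M$): - $\mathcal T_{V,M}(x)=\mathsf v_{i,j}$, where $i=\min\{i'\mid x\in V_{i'}\}$ and $j=\min\{j'\mid x=V_{ij'}\}$; - $\mathcal T_{V,M}(\hat x)=\mathsf m_{i,j}$, defined likewise using $M$; - homomorphic on applications; - $\mathcal T_{V,M}(\lambda_\theta p.s)=\lambda_{|\theta|}\mathcal T_{V,\theta++M}(p).\mathcal T_{\theta++V,M}(s)$. Backward translation $\mathcal U_{V,M}$ (for $V,M$ lists of lists of distinct symbols with $V_{ij}$ defined for $(i,j)\in fv(t)$ and $M_{ij}$ defined for $(i,j)\in fm(t)$): - $\mathcal U_{V,M}(\mathsf v_{i,j})=V_{ij}$ and $\mathcal U_{V,M}(\mathsf m_{i,j})=\widehat{M_{ij}}$; - homomorphic on applications; - $\mathcal U_{V,M}(\lambda_np.s)=\lambda_\theta\mathcal U_{V,\theta++M}(p).\mathcal U_{\theta++V,M}(s)$, with $\theta$ a list of $n$ fresh symbols. Fix an enumeration $x_1,x_2,\dots$ of the symbols. - $\mathcal T(s)=\mathcal T_{X,X}(s)$ with $X=[[x_1],\dots,[x_n]]$,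 where $fv(s)\cup fm(s)\subseteq\{x_1,\dots,x_n\}$. - $\mathcal U(t)=\mathcal U_{X,X}(t)$ with $X=[[x_1],\dots,[x_n]]$, where $fv(t)\cup fm(t)\subseteq\{(1,1),\dots,(n,1)\}$. -}

module Defs where

open import Data.Nat using (ℕ; zero; suc; _+_; _<_; _≤_; _⊔_; _≡ᵇ_; _<ᵇ_; _<?_)
open import Data.Bool using (Bool; true; false; if_then_else_; not)
open import Data.List using (List; []; _∷_; _++_; map; filter; length; concat; foldr; applyUpTo)
open import Data.Bool.ListAction using (any)
open import Data.List.Relation.Unary.All using (All)
open import Data.Maybe using (Maybe; just; nothing)
open import Data.Product using (_×_; _,_; proj₁; proj₂)
open import Data.Unit using (⊤)
open import Data.Fin using (Fin; toℕ; fromℕ<)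
open import Data.Fin.Permutation using (Permutation′; _⟨$⟩ʳ_)
open import Relation.Nullary using (yes; no)
open import Relation.Binary.PropositionalEquality using (_≡_)

-- Symbols: ℕ (a countably infinite set).  Enumeration x_i = i ∸ 1,
-- i.e. x_1 = 0, x_2 = 1, ...

Sym : Set
Sym = ℕ

_∈ᵇ_ : Sym → List Sym → Bool
x ∈ᵇ θ = any (x ≡ᵇ_) θ

-- PPC terms:  t ::= x | x̂ | t t | λ_θ p.s

data Term : Set where
  var : Sym → Term
  mat : Sym → Term
  app : Term → Term → Term
  lam : List Sym → Term → Term → Term

_∖_ : List Sym → List Sym → List Sym
xs ∖ θ = filter (λ x → not (x ∈ᵇ θ) Data.Bool.≟ true) xs
  where import Data.Bool

fv : Term → List Sym
fv (var x) = x ∷ []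
fv (mat x) = []
fv (app a b) = fv a ++ fv b
fv (lam θ p s) = fv p ++ (fv s ∖ θ)

fm : Term → List Sym
fm (var x) = []
fm (mat x) = x ∷ []
fm (app a b) = fm a ++ fm b
fm (lam θ p s) = (fm p ∖ θ) ++ fm s

-- A symbol occurrence, relative to a stack of binder lists Γ, is either
-- bound at position (i , j) (first list containing it, first position in
-- that list; 0-based) or free.

data Occ : Set where
  bound : ℕ → ℕ → Occ
  free  : Sym → Occ

posIn : Sym → List Sym → Maybe ℕ
posIn x [] = nothing
posIn x (y ∷ ys) = if x ≡ᵇ y then just 0 else Data.Maybe.map suc (posIn x ys)
  where import Data.Maybe

locate : List (List Sym) → Sym → Maybe (ℕ × ℕ)
locate [] x = nothing
locate (θ ∷ Γ) x with posIn x θ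
... | just j  = just (0 , j)
... | nothing with locate Γ x
...   | just (i , j) = just (suc i , j)
...   | nothing      = nothing

occ : List (List Sym) → Sym → Occ
occ Γ x with locate Γ x
... | just (i , j) = bound i j
... | nothing      = free x

-- AlphaEnv Vs Vs' Ms Ms' s s' : s and s' are α-equivalent, where Vs/Vs'
-- are the stacks of binders in scope for variables and Ms/Ms' those for
-- matchables (in λ_θ p.s, θ is pushed on the matchable stack for p and on
-- the variable stack for s).
data AlphaEnv : List (List Sym) → List (List Sym) → List (List Sym) → List (List Sym) → Term → Term → Set where
  α-var : ∀ {Vs Vs' Ms Ms' x y} → occ Vs x ≡ occ Vs' y → AlphaEnv Vs Vs' Ms Ms' (var x) (var y)
  α-mat : ∀ {Vs Vs' Ms Ms' x y} → occ Ms x ≡ occ Ms' y → AlphaEnv Vs Vs' Ms Ms' (mat x) (mat y)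
  α-app : ∀ {Vs Vs' Ms Ms' a b a' b'} → AlphaEnv Vs Vs' Ms Ms' a a' → AlphaEnv Vs Vs' Ms Ms' b b' →
          AlphaEnv Vs Vs' Ms Ms' (app a b) (app a' b')
  α-lam : ∀ {Vs Vs' Ms Ms' θ θ' p s p' s'} → length θ ≡ length θ' →
          AlphaEnv Vs Vs' (θ ∷ Ms) (θ' ∷ Ms') p p' →
          AlphaEnv (θ ∷ Vs) (θ' ∷ Vs') Ms Ms' s s' →
          AlphaEnv Vs Vs' Ms Ms' (lam θ p s) (lam θ' p' s')

_=α_ : Term → Term → Set
s =α s' = AlphaEnv [] [] [] [] s s'

-- PPC_dB terms.  Indices are stored 0-based:
--   vv i j  represents  v_{i+1, j+1},   mm i j  represents  m_{i+1, j+1}.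

data DB : Set where
  vv  : ℕ → ℕ → DB
  mm  : ℕ → ℕ → DB
  app : DB → DB → DB
  lam : ℕ → DB → DB → DB

-- S - 1 (0-based: drop primary index 0, decrement the others)
dec : List (ℕ × ℕ) → List (ℕ × ℕ)
dec [] = []
dec ((zero , j) ∷ S) = dec S
dec ((suc i , j) ∷ S) = (i , j) ∷ dec S

fvdB : DB → List (ℕ × ℕ)
fvdB (vv i j) = (i , j) ∷ []
fvdB (mm i j) = []
fvdB (app a b) = fvdB a ++ fvdB b
fvdB (lam n p s) = fvdB p ++ dec (fvdB s)

fmdB : DB → List (ℕ × ℕ)
fmdB (vv i j) = []
fmdB (mm i j) = (i , j) ∷ []
fmdB (app a b) = fmdB a ++ fmdB b
fmdB (lam n p s) = dec (fmdB p) ++ fmdB s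

AbsOK : DB → Set
AbsOK (vv i j) = ⊤
AbsOK (mm i j) = ⊤
AbsOK (app a b) = AbsOK a × AbsOK b
AbsOK (lam n p s) = All (λ ij → proj₁ ij ≡ 0 → proj₂ ij < n) (fmdB p ++ fvdB s) × AbsOK p × AbsOK s

WellFormed : DB → Set
WellFormed t = All (λ ij → proj₂ ij ≡ 0) (fvdB t ++ fmdB t) × AbsOK t

-- Equality modulo permutation of the secondary indices bound by a same
-- abstraction.  permV k f t applies f to the secondary index of variables
-- bound by the abstraction k levels above (0-based primary index k);
-- permM likewise for matchables.
permV : ℕ → (ℕ → ℕ) → DB → DB
permV k f (vv i j) = if i ≡ᵇ k then vv i (f j) else vv i j
permV k f (mm i j) = mm i j
permV k f (app a b) = app (permV k f a) (permV k f b)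
permV k f (lam n p s) = lam n (permV k f p) (permV (suc k) f s)

permM : ℕ → (ℕ → ℕ) → DB → DB
permM k f (vv i j) = vv i j
permM k f (mm i j) = if i ≡ᵇ k then mm i (f j) else mm i j
permM k f (app a b) = app (permM k f a) (permM k f b)
permM k f (lam n p s) = lam n (permM (suc k) f p) (permM k f s)

liftPerm : {n : ℕ} → Permutation′ n → ℕ → ℕ
liftPerm {n} π j with j <? n
... | yes j<n = toℕ (π ⟨$⟩ʳ fromℕ< j<n)
... | no  _   = j

data _≈dB_ : DB → DB → Set where
  ≈-refl  : ∀ {t} → t ≈dB t
  ≈-sym   : ∀ {t u} → t ≈dB u → u ≈dB t
  ≈-trans : ∀ {t u w} → t ≈dB u → u ≈dB w → t ≈dB w
  ≈-app   : ∀ {a b a' b'} → a ≈dB a' → b ≈dB b' → app a b ≈dB app a' b'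
  ≈-lam   : ∀ {n p s p' s'} → p ≈dB p' → s ≈dB s' → lam n p s ≈dB lam n p' s'
  ≈-perm  : ∀ {n p s} (π : Permutation′ n) →
            lam n p s ≈dB lam n (permM 0 (liftPerm π) p) (permV 0 (liftPerm π) s)

-- The fallback (0 , 0) is never used when fv(t) ⊆ ⋃V (resp.
-- fm(t) ⊆ ⋃M), which is the side condition under which T is defined.
idx : List (List Sym) → Sym → ℕ × ℕ
idx Γ x with locate Γ x
... | just ij = ij
... | nothing = (0 , 0)

Tr : List (List Sym) → List (List Sym) → Term → DB
Tr V M (var x) = vv (proj₁ (idx V x)) (proj₂ (idx V x))
Tr V M (mat x) = mm (proj₁ (idx M x)) (proj₂ (idx M x))
Tr V M (app a b) = app (Tr V M a) (Tr V M b)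
Tr V M (lam θ p s) = lam (length θ) (Tr V (θ ∷ M) p) (Tr (θ ∷ V) M s)

-- V_ij (0-based); the fallback 0 is never used under the side condition
-- that V_ij is defined for all free (i , j).
look : List (List Sym) → ℕ → ℕ → Sym
look [] i j = 0
look (θ ∷ Γ) (suc i) j = look Γ i j
look ([] ∷ Γ) zero j = 0
look ((x ∷ θ) ∷ Γ) zero zero = x
look ((x ∷ θ) ∷ Γ) zero (suc j) = look (θ ∷ Γ) zero j

maxSym : List (List Sym) → Sym
maxSym Γ = foldr _⊔_ 0 (concat Γ)

fresh : List (List Sym) → List (List Sym) → ℕ → List Sym
fresh V M n = applyUpTo (λ k → suc (maxSym V ⊔ maxSym M) + k) n

Un : List (List Sym) → List (List Sym) → DB → Term
Un V M (vv i j) = var (look V i j)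
Un V M (mm i j) = mat (look M i j)
Un V M (app a b) = app (Un V M a) (Un V M b)
Un V M (lam n p s) = lam θ (Un V (θ ∷ M) p) (Un (θ ∷ V) M s)
  where θ = fresh V M n

-- Top-level translations with X = [[x_1], …, [x_n]]

X : ℕ → List (List Sym)
X n = applyUpTo (λ k → k ∷ []) n

T : ℕ → Term → DB
T n s = Tr (X n) (X n) s

U : ℕ → DB → Term
U n t = Un (X n) (X n) t

SymsBelow : ℕ → Term → Set
SymsBelow n s = All (_< n) (fv s ++ fm s)

IdxBelow : ℕ → DB → Set
IdxBelow n t = All (λ ij → proj₁ ij < n × proj₂ ij ≡ 0) (fvdB t ++ fmdB t)

module Submission where

-- Both round trips are proved for arbitrary environments by
-- structural induction, under an invariant relating the environments used by
-- the two translations at each free index / free symbol: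
--
--  * T (U t) = t  (even syntactically).  Invariant `Recovers V V'`: the symbol
--    U_V reads at index (i , j) is located by T_{V'} at the same (i , j).
--    Under a binder λ_n both environments are extended by the fresh list
--    θ = U's fresh symbols; well-formedness bounds the new level-0 indices by
--    n, and freshness keeps the other symbols from being captured by θ.
--  * U (T s) =α s.  Invariant `Agrees`: T_V locates a free symbol x at some
--    (i , j), and the symbol U_{V'} puts back at (i , j) has the same binder
--    occurrence as x relative to the α-equivalence scopes.

open import Defs
open import Data.Nat using (ℕ; zero; suc; _+_; _<_; _≤_; _⊔_; _≡ᵇ_; z≤n; s≤s)
open import Data.Nat.Properties
open import Data.Bool using (true; false; not) renaming (T to IsTrue)
import Data.Bool as Bool
open import Data.List using (List; []; _∷_; _++_; length; concat; foldr; applyUpTo)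
open import Data.List.Properties using (length-applyUpTo; foldr-++)
open import Data.List.Membership.Propositional using (_∈_)
open import Data.List.Membership.Propositional.Properties using (∈-filter⁺; ∈-filter⁻; ∈-++⁺ˡ; ∈-++⁺ʳ; ∈-++⁻)
open import Data.List.Relation.Unary.Any using (here; there)
open import Data.List.Relation.Unary.All using (All; []; _∷_) renaming (lookup to All-lookup; tabulate to All-tabulate)
open import Data.List.Relation.Unary.All.Properties using (++⁻)
open import Data.Maybe using (Maybe; just; nothing)
import Data.Maybe as Maybe
open import Data.Product using (_×_; _,_; proj₁; proj₂; Σ)
open import Data.Sum using (inj₁; inj₂)
open import Relation.Nullary using (contradiction)
open import Relation.Binary.PropositionalEquality

≡ᵇ-refl : ∀ m → (m ≡ᵇ m) ≡ true
≡ᵇ-refl zero = refl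
≡ᵇ-refl (suc m) = ≡ᵇ-refl m

≡ᵇ-false : ∀ m n → m ≢ n → (m ≡ᵇ n) ≡ false
≡ᵇ-false m n m≢n with m ≡ᵇ n in eq
... | true = contradiction (≡ᵇ⇒≡ m n (subst IsTrue (sym eq) _)) m≢n
... | false = refl

map-suc-nothing : ∀ {m : Maybe ℕ} → Maybe.map suc m ≡ nothing → m ≡ nothing
map-suc-nothing {nothing} _ = refl

posIn-nothing⇒∉ : ∀ x θ → posIn x θ ≡ nothing → not (x ∈ᵇ θ) ≡ true
posIn-nothing⇒∉ x [] _ = refl
posIn-nothing⇒∉ x (y ∷ θ) eq with x ≡ᵇ y
... | false = posIn-nothing⇒∉ x θ (map-suc-nothing eq)

∉⇒posIn-nothing : ∀ x θ → not (x ∈ᵇ θ) ≡ true → posIn x θ ≡ nothing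
∉⇒posIn-nothing x [] _ = refl
∉⇒posIn-nothing x (y ∷ θ) eq with x ≡ᵇ y
... | false rewrite ∉⇒posIn-nothing x θ eq = refl

posIn-< : ∀ x θ j → posIn x θ ≡ just j → j < length θ
posIn-< x (y ∷ θ) j eq with x ≡ᵇ y
posIn-< x (y ∷ θ) j refl | true = s≤s z≤n
posIn-< x (y ∷ θ) j eq | false with posIn x θ in eq′ | eq
... | just k | refl = s≤s (posIn-< x θ k eq′)

∈-∖⁺ : ∀ θ x {xs} → posIn x θ ≡ nothing → x ∈ xs → x ∈ (xs ∖ θ)
∈-∖⁺ θ x eq x∈xs = ∈-filter⁺ (λ y → not (y ∈ᵇ θ) Bool.≟ true) x∈xs (posIn-nothing⇒∉ x θ eq)

∈-∖⁻ : ∀ θ x xs → x ∈ (xs ∖ θ) → x ∈ xs × posIn x θ ≡ nothing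
∈-∖⁻ θ x xs x∈ with ∈-filter⁻ (λ y → not (y ∈ᵇ θ) Bool.≟ true) {xs = xs} x∈
... | x∈xs , p = x∈xs , ∉⇒posIn-nothing x θ p

locate-here : ∀ θ Γ {x j} → posIn x θ ≡ just j → locate (θ ∷ Γ) x ≡ just (0 , j)
locate-here θ Γ eq rewrite eq = refl

locate-there : ∀ θ Γ {x i j} → posIn x θ ≡ nothing → locate Γ x ≡ just (i , j) →
               locate (θ ∷ Γ) x ≡ just (suc i , j)
locate-there θ Γ eq eq′ rewrite eq | eq′ = refl

locate-absent : ∀ θ Γ {x} → posIn x θ ≡ nothing → locate Γ x ≡ nothing → locate (θ ∷ Γ) x ≡ nothing
locate-absent θ Γ eq eq′ rewrite eq | eq′ = refl

occ-located : ∀ Γ {x i j} → locate Γ x ≡ just (i , j) → occ Γ x ≡ bound i j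
occ-located Γ eq rewrite eq = refl

occ-absent : ∀ Γ {x} → locate Γ x ≡ nothing → occ Γ x ≡ free x
occ-absent Γ eq rewrite eq = refl

idx-located : ∀ Γ {x ij} → locate Γ x ≡ just ij → idx Γ x ≡ ij
idx-located Γ eq rewrite eq = refl

shift : Occ → Occ
shift (bound i j) = bound (suc i) j
shift (free x) = free x

occ-there : ∀ θ Γ {x} → posIn x θ ≡ nothing → occ (θ ∷ Γ) x ≡ shift (occ Γ x)
occ-there θ Γ {x} eq with locate Γ x in eq′
... | just (i , j) = occ-located (θ ∷ Γ) (locate-there θ Γ eq eq′)
... | nothing = occ-absent (θ ∷ Γ) (locate-absent θ Γ eq eq′)

foldr-⊔-≥ : ∀ b xs → b ≤ foldr _⊔_ b xs
foldr-⊔-≥ b [] = ≤-refl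
foldr-⊔-≥ b (x ∷ xs) = ≤-trans (foldr-⊔-≥ b xs) (m≤n⊔m x _)

maxSym-∷ : ∀ θ Γ → maxSym Γ ≤ maxSym (θ ∷ Γ)
maxSym-∷ θ Γ = subst (maxSym Γ ≤_) (sym (foldr-++ _⊔_ 0 θ (concat Γ))) (foldr-⊔-≥ _ θ)

look-≤-maxSym : ∀ Γ i j → look Γ i j ≤ maxSym Γ
look-≤-maxSym [] i j = z≤n
look-≤-maxSym (θ ∷ Γ) (suc i) j = ≤-trans (look-≤-maxSym Γ i j) (maxSym-∷ θ Γ)
look-≤-maxSym ([] ∷ Γ) zero j = z≤n
look-≤-maxSym ((x ∷ θ) ∷ Γ) zero zero = m≤m⊔n x _
look-≤-maxSym ((x ∷ θ) ∷ Γ) zero (suc j) = ≤-trans (look-≤-maxSym (θ ∷ Γ) zero j) (m≤n⊔m x _)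

posIn-applyUpTo-below : ∀ y g n → (∀ k → y < g k) → posIn y (applyUpTo g n) ≡ nothing
posIn-applyUpTo-below y g zero _ = refl
posIn-applyUpTo-below y g (suc n) y<g
  rewrite ≡ᵇ-false y (g 0) (<⇒≢ (y<g 0))
        | posIn-applyUpTo-below y (λ k → g (suc k)) n (λ k → y<g (suc k)) = refl

posIn-applyUpTo-inj : ∀ g n j → (∀ a b → g a ≡ g b → a ≡ b) → j < n → posIn (g j) (applyUpTo g n) ≡ just j
posIn-applyUpTo-inj g (suc n) zero inj _ rewrite ≡ᵇ-refl (g 0) = refl
posIn-applyUpTo-inj g (suc n) (suc j) inj (s≤s j<n)
  rewrite ≡ᵇ-false (g (suc j)) (g 0) (λ eq → 0≢1+n (sym (inj _ _ eq)))
        | posIn-applyUpTo-inj (λ k → g (suc k)) n j (λ a b eq → suc-injective (inj _ _ eq)) j<n = refl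

look-applyUpTo : ∀ g n j Γ → j < n → look (applyUpTo g n ∷ Γ) 0 j ≡ g j
look-applyUpTo g (suc n) zero Γ _ = refl
look-applyUpTo g (suc n) (suc j) Γ (s≤s j<n) = look-applyUpTo (λ k → g (suc k)) n j Γ j<n

-- The fresh list used by U is `Fresh (maxSym V ⊔ maxSym M) n` definitionally:
-- n consecutive symbols above a bound m.
Fresh : ℕ → ℕ → List Sym
Fresh m n = applyUpTo (λ k → suc m + k) n

fresh-avoids : ∀ m n y → y ≤ m → posIn y (Fresh m n) ≡ nothing
fresh-avoids m n y y≤m = posIn-applyUpTo-below y _ n (λ k → s≤s (≤-trans y≤m (m≤m+n m k)))

fresh-position : ∀ m n j Γ → j < n → posIn (look (Fresh m n ∷ Γ) 0 j) (Fresh m n) ≡ just j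
fresh-position m n j Γ j<n rewrite look-applyUpTo (λ k → suc m + k) n j Γ j<n =
  posIn-applyUpTo-inj _ n j (+-cancelˡ-≡ (suc m)) j<n

look-singletons : ∀ (g : ℕ → Sym) n i → i < n → look (applyUpTo (λ k → g k ∷ []) n) i 0 ≡ g i
look-singletons g (suc n) zero _ = refl
look-singletons g (suc n) (suc i) (s≤s i<n) = look-singletons (λ k → g (suc k)) n i i<n

locate-singletons : ∀ (g : ℕ → Sym) n i y → i < n → g i ≡ y → (∀ k → k < i → g k ≢ y) →
                    locate (applyUpTo (λ k → g k ∷ []) n) y ≡ just (i , 0)
locate-singletons g (suc n) zero y _ refl _ = locate-here (g 0 ∷ []) (applyUpTo (λ k → g (suc k) ∷ []) n) {x = g 0} posIn-head
  where
  posIn-head : posIn (g 0) (g 0 ∷ []) ≡ just 0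
  posIn-head rewrite ≡ᵇ-refl (g 0) = refl
locate-singletons g (suc n) (suc i) y (s≤s i<n) gi≡y earlier =
  locate-there (g 0 ∷ []) (applyUpTo (λ k → g (suc k) ∷ []) n) posIn-head (locate-singletons (λ k → g (suc k)) n i y i<n gi≡y (λ k k<i → earlier (suc k) (s≤s k<i)))
  where
  posIn-head : posIn y (g 0 ∷ []) ≡ nothing
  posIn-head rewrite ≡ᵇ-false y (g 0) (λ eq → earlier 0 (s≤s z≤n) (sym eq)) = refl

look-X : ∀ n i → i < n → look (X n) i 0 ≡ i
look-X n i = look-singletons (λ k → k) n i

locate-X : ∀ n i → i < n → locate (X n) i ≡ just (i , 0)
locate-X n i i<n = locate-singletons (λ k → k) n i i i<n refl (λ k k<i → <⇒≢ k<i)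

Recovers : List (List Sym) → List (List Sym) → ℕ × ℕ → Set
Recovers V V' (i , j) = locate V' (look V i j) ≡ just (i , j)

-- Indices bounded below λ_n are split into level 0 (bounded by n, by
-- well-formedness) and deeper levels, which are the indices of S - 1.
All-dec : ∀ {P R : ℕ × ℕ → Set} n S → (∀ j → j < n → R (0 , j)) → (∀ i j → P (i , j) → R (suc i , j)) →
          All P (dec S) → All (λ ij → proj₁ ij ≡ 0 → proj₂ ij < n) S → All R S
All-dec n [] _ _ _ _ = []
All-dec n ((zero , j) ∷ S) level0 deeper ps (b ∷ bs) = level0 j (b refl) ∷ All-dec n S level0 deeper ps bs
All-dec n ((suc i , j) ∷ S) level0 deeper (p ∷ ps) (_ ∷ bs) = deeper i j p ∷ All-dec n S level0 deeper ps bs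

Recovers-push : ∀ m n V V' S → maxSym V ≤ m → All (Recovers V V') (dec S) →
                All (λ ij → proj₁ ij ≡ 0 → proj₂ ij < n) S → All (Recovers (Fresh m n ∷ V) (Fresh m n ∷ V')) S
Recovers-push m n V V' S V≤m =
  All-dec n S (λ j j<n → locate-here (Fresh m n) V' (fresh-position m n j V j<n))
              (λ i j → locate-there (Fresh m n) V' (fresh-avoids m n _ (≤-trans (look-≤-maxSym V i j) V≤m)))

lam-cong : ∀ {n n′ p p′ s s′} → n ≡ n′ → p ≡ p′ → s ≡ s′ → DB.lam n p s ≡ DB.lam n′ p′ s′
lam-cong refl refl refl = refl

Tr-Un : ∀ t V M V' M' → All (Recovers V V') (fvdB t) → All (Recovers M M') (fmdB t) → AbsOK t →
        Tr V' M' (Un V M t) ≡ t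
Tr-Un (vv i j) V M V' M' (r ∷ []) _ _ = cong (λ ij → vv (proj₁ ij) (proj₂ ij)) (idx-located V' r)
Tr-Un (mm i j) V M V' M' _ (r ∷ []) _ = cong (λ ij → mm (proj₁ ij) (proj₂ ij)) (idx-located M' r)
Tr-Un (app a b) V M V' M' rv rm (oka , okb) =
  cong₂ DB.app (Tr-Un a V M V' M' (proj₁ (++⁻ (fvdB a) rv)) (proj₁ (++⁻ (fmdB a) rm)) oka)
               (Tr-Un b V M V' M' (proj₂ (++⁻ (fvdB a) rv)) (proj₂ (++⁻ (fmdB a) rm)) okb)
Tr-Un (lam n p s) V M V' M' rv rm (bounded , okp , oks) =
  lam-cong (length-applyUpTo _ n)
    (Tr-Un p V (θ ∷ M) V' (θ ∷ M') (proj₁ (++⁻ (fvdB p) rv))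
       (Recovers-push m n M M' (fmdB p) (m≤n⊔m _ _) (proj₁ (++⁻ (dec (fmdB p)) rm)) (proj₁ (++⁻ (fmdB p) bounded)))
       okp)
    (Tr-Un s (θ ∷ V) M (θ ∷ V') M'
       (Recovers-push m n V V' (fvdB s) (m≤m⊔n _ _) (proj₂ (++⁻ (fvdB p) rv)) (proj₂ (++⁻ (fmdB p) bounded)))
       (proj₂ (++⁻ (dec (fmdB p)) rm)) oks)
  where
  m : ℕ
  m = maxSym V ⊔ maxSym M
  θ : List Sym
  θ = Fresh m n

Agrees : List (List Sym) → List (List Sym) → List (List Sym) → List (List Sym) → Sym → Set
Agrees Γ' Γ V V' x = Σ (ℕ × ℕ) λ ij → locate V x ≡ just ij × occ Γ' (look V' (proj₁ ij) (proj₂ ij)) ≡ occ Γ x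

-- Symbols of θ agree at level
-- 0; the others (which survive `∖ θ`) agree one level deeper.
Agrees-push : ∀ θ Γ' Γ V V' m xs → maxSym V' ≤ m → All (Agrees Γ' Γ V V') (xs ∖ θ) →
              All (Agrees (Fresh m (length θ) ∷ Γ') (θ ∷ Γ) (θ ∷ V) (Fresh m (length θ) ∷ V')) xs
Agrees-push θ Γ' Γ V V' m xs V'≤m outer = All-tabulate λ {x} x∈xs → agree x x∈xs (posIn x θ) refl
  where
  θ′ : List Sym
  θ′ = Fresh m (length θ)
  agree : ∀ x → x ∈ xs → (r : Maybe ℕ) → posIn x θ ≡ r → Agrees (θ′ ∷ Γ') (θ ∷ Γ) (θ ∷ V) (θ′ ∷ V') x
  agree x _ (just j) eq =
    (0 , j) , locate-here θ V eq ,
    trans (occ-located (θ′ ∷ Γ') (locate-here θ′ Γ' (fresh-position m (length θ) j V' (posIn-< x θ j eq))))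
          (sym (occ-located (θ ∷ Γ) (locate-here θ Γ eq)))
  agree x x∈xs nothing eq with All-lookup outer (∈-∖⁺ θ x eq x∈xs)
  ... | (i , j) , loc , same =
    (suc i , j) , locate-there θ V eq loc ,
    trans (occ-there θ′ Γ' (fresh-avoids m (length θ) _ (≤-trans (look-≤-maxSym V' i j) V'≤m)))
          (trans (cong shift same) (sym (occ-there θ Γ eq)))

Un-Tr : ∀ s Γ' Γ Γm' Γm V M V' M' → All (Agrees Γ' Γ V V') (fv s) → All (Agrees Γm' Γm M M') (fm s) →
        AlphaEnv Γ' Γ Γm' Γm (Un V' M' (Tr V M s)) s
Un-Tr (var x) Γ' Γ Γm' Γm V M V' M' ((ij , loc , same) ∷ []) _ =
  α-var (trans (cong (λ ij → occ Γ' (look V' (proj₁ ij) (proj₂ ij))) (idx-located V loc)) same)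
Un-Tr (mat x) Γ' Γ Γm' Γm V M V' M' _ ((ij , loc , same) ∷ []) =
  α-mat (trans (cong (λ ij → occ Γm' (look M' (proj₁ ij) (proj₂ ij))) (idx-located M loc)) same)
Un-Tr (app a b) Γ' Γ Γm' Γm V M V' M' av am =
  α-app (Un-Tr a Γ' Γ Γm' Γm V M V' M' (proj₁ (++⁻ (fv a) av)) (proj₁ (++⁻ (fm a) am)))
        (Un-Tr b Γ' Γ Γm' Γm V M V' M' (proj₂ (++⁻ (fv a) av)) (proj₂ (++⁻ (fm a) am)))
Un-Tr (lam θ p s) Γ' Γ Γm' Γm V M V' M' av am =
  α-lam (length-applyUpTo _ (length θ))
    (Un-Tr p Γ' Γ (θ′ ∷ Γm') (θ ∷ Γm) V (θ ∷ M) V' (θ′ ∷ M') (proj₁ (++⁻ (fv p) av))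
       (Agrees-push θ Γm' Γm M M' m (fm p) (m≤n⊔m _ _) (proj₁ (++⁻ (fm p ∖ θ) am))))
    (Un-Tr s (θ′ ∷ Γ') (θ ∷ Γ) Γm' Γm (θ ∷ V) M (θ′ ∷ V') M'
       (Agrees-push θ Γ' Γ V V' m (fv s) (m≤m⊔n _ _) (proj₂ (++⁻ (fv p) av)))
       (proj₂ (++⁻ (fm p ∖ θ) am)))
  where
  m : ℕ
  m = maxSym V' ⊔ maxSym M'
  θ′ : List Sym
  θ′ = Fresh m (length θ)

dec⁻ : ∀ {i j} S → (i , j) ∈ dec S → (suc i , j) ∈ S
dec⁻ ((zero , _) ∷ S) i∈ = there (dec⁻ S i∈)
dec⁻ ((suc _ , _) ∷ S) (here refl) = here refl
dec⁻ ((suc _ , _) ∷ S) (there i∈) = there (dec⁻ S i∈)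

dec⁺ : ∀ {i j} S → (suc i , j) ∈ S → (i , j) ∈ dec S
dec⁺ ((zero , _) ∷ S) (there i∈) = dec⁺ S i∈
dec⁺ ((suc _ , _) ∷ S) (here refl) = here refl
dec⁺ ((suc _ , _) ∷ S) (there i∈) = there (dec⁺ S i∈)

-- Free indices of t become free symbols of U_{V,M}(t): fresh binders never
-- capture a symbol already stored in V or M.

look-∈-fv-Un : ∀ t V M {i j} → (i , j) ∈ fvdB t → look V i j ∈ fv (Un V M t)
look-∈-fv-Un (vv i j) V M (here refl) = here refl
look-∈-fv-Un (app a b) V M i∈ with ∈-++⁻ (fvdB a) i∈
... | inj₁ i∈a = ∈-++⁺ˡ (look-∈-fv-Un a V M i∈a)
... | inj₂ i∈b = ∈-++⁺ʳ (fv (Un V M a)) (look-∈-fv-Un b V M i∈b)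
look-∈-fv-Un (lam n p s) V M {i} {j} i∈ with ∈-++⁻ (fvdB p) i∈
... | inj₁ i∈p = ∈-++⁺ˡ (look-∈-fv-Un p V (fresh V M n ∷ M) i∈p)
... | inj₂ i∈s = ∈-++⁺ʳ (fv (Un V (fresh V M n ∷ M) p))
      (∈-∖⁺ (fresh V M n) _ (fresh-avoids _ n _ (≤-trans (look-≤-maxSym V i j) (m≤m⊔n _ _)))
         (look-∈-fv-Un s (fresh V M n ∷ V) M (dec⁻ (fvdB s) i∈s)))

look-∈-fm-Un : ∀ t V M {i j} → (i , j) ∈ fmdB t → look M i j ∈ fm (Un V M t)
look-∈-fm-Un (mm i j) V M (here refl) = here refl
look-∈-fm-Un (app a b) V M i∈ with ∈-++⁻ (fmdB a) i∈
... | inj₁ i∈a = ∈-++⁺ˡ (look-∈-fm-Un a V M i∈a)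
... | inj₂ i∈b = ∈-++⁺ʳ (fm (Un V M a)) (look-∈-fm-Un b V M i∈b)
look-∈-fm-Un (lam n p s) V M {i} {j} i∈ with ∈-++⁻ (dec (fmdB p)) i∈
... | inj₁ i∈p = ∈-++⁺ˡ (∈-∖⁺ (fresh V M n) _ (fresh-avoids _ n _ (≤-trans (look-≤-maxSym M i j) (m≤n⊔m _ _)))
         (look-∈-fm-Un p V (fresh V M n ∷ M) (dec⁻ (fmdB p) i∈p)))
... | inj₂ i∈s = ∈-++⁺ʳ (fm (Un V (fresh V M n ∷ M) p) ∖ fresh V M n) (look-∈-fm-Un s (fresh V M n ∷ V) M i∈s)

idx-∈-fvdB-Tr : ∀ s V M {x i j} → x ∈ fv s → locate V x ≡ just (i , j) → (i , j) ∈ fvdB (Tr V M s)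
idx-∈-fvdB-Tr (var x) V M (here refl) loc rewrite idx-located V loc = here refl
idx-∈-fvdB-Tr (app a b) V M x∈ loc with ∈-++⁻ (fv a) x∈
... | inj₁ x∈a = ∈-++⁺ˡ (idx-∈-fvdB-Tr a V M x∈a loc)
... | inj₂ x∈b = ∈-++⁺ʳ (fvdB (Tr V M a)) (idx-∈-fvdB-Tr b V M x∈b loc)
idx-∈-fvdB-Tr (lam θ p s) V M {x} x∈ loc with ∈-++⁻ (fv p) x∈
... | inj₁ x∈p = ∈-++⁺ˡ (idx-∈-fvdB-Tr p V (θ ∷ M) x∈p loc)
... | inj₂ x∈s with ∈-∖⁻ θ x (fv s) x∈s
...   | x∈s′ , x∉θ = ∈-++⁺ʳ (fvdB (Tr V (θ ∷ M) p))
          (dec⁺ (fvdB (Tr (θ ∷ V) M s)) (idx-∈-fvdB-Tr s (θ ∷ V) M x∈s′ (locate-there θ V x∉θ loc)))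

idx-∈-fmdB-Tr : ∀ s V M {x i j} → x ∈ fm s → locate M x ≡ just (i , j) → (i , j) ∈ fmdB (Tr V M s)
idx-∈-fmdB-Tr (mat x) V M (here refl) loc rewrite idx-located M loc = here refl
idx-∈-fmdB-Tr (app a b) V M x∈ loc with ∈-++⁻ (fm a) x∈
... | inj₁ x∈a = ∈-++⁺ˡ (idx-∈-fmdB-Tr a V M x∈a loc)
... | inj₂ x∈b = ∈-++⁺ʳ (fmdB (Tr V M a)) (idx-∈-fmdB-Tr b V M x∈b loc)
idx-∈-fmdB-Tr (lam θ p s) V M {x} x∈ loc with ∈-++⁻ (fm p ∖ θ) x∈
... | inj₂ x∈s = ∈-++⁺ʳ (dec (fmdB (Tr V (θ ∷ M) p))) (idx-∈-fmdB-Tr s (θ ∷ V) M x∈s loc)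
... | inj₁ x∈p with ∈-∖⁻ θ x (fm p) x∈p
...   | x∈p′ , x∉θ = ∈-++⁺ˡ
          (dec⁺ (fmdB (Tr V (θ ∷ M) p)) (idx-∈-fmdB-Tr p V (θ ∷ M) x∈p′ (locate-there θ M x∉θ loc)))

recovers-X : ∀ n n' {ij} → proj₁ ij < n × proj₂ ij ≡ 0 → look (X n) (proj₁ ij) (proj₂ ij) < n' →
             Recovers (X n) (X n') ij
recovers-X n n' {i , .0} (i<n , refl) i<n' rewrite look-X n i i<n = locate-X n' i i<n'

agrees-X : ∀ n n' {x} → x < n → x < n' → Agrees [] [] (X n) (X n') x
agrees-X n n' {x} x<n x<n' = (x , 0) , locate-X n x x<n , cong free (look-X n' x x<n')

theorem4p13 : (∀ (t : DB) → WellFormed t → ∀ (n : ℕ) → IdxBelow n t →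
    ∀ (n' : ℕ) → SymsBelow n' (U n t) → T n' (U n t) ≈dB t)
    × (∀ (s : Term) → ∀ (n : ℕ) → SymsBelow n s →
    ∀ (n' : ℕ) → IdxBelow n' (T n s) → U n' (T n s) =α s)
theorem4p13 = T∘U , U∘T
  where
  T∘U : ∀ t → WellFormed t → ∀ n → IdxBelow n t → ∀ n' → SymsBelow n' (U n t) → T n' (U n t) ≈dB t
  T∘U t (_ , absOK) n idxs n' syms = subst (_≈dB t) (sym (Tr-Un t (X n) (X n) (X n') (X n') onFv onFm absOK)) ≈-refl
    where
    onFv : All (Recovers (X n) (X n')) (fvdB t)
    onFv = All-tabulate λ i∈ → recovers-X n n' (All-lookup idxs (∈-++⁺ˡ i∈))
                                 (All-lookup syms (∈-++⁺ˡ (look-∈-fv-Un t (X n) (X n) i∈)))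
    onFm : All (Recovers (X n) (X n')) (fmdB t)
    onFm = All-tabulate λ i∈ → recovers-X n n' (All-lookup idxs (∈-++⁺ʳ (fvdB t) i∈))
                                 (All-lookup syms (∈-++⁺ʳ (fv (U n t)) (look-∈-fm-Un t (X n) (X n) i∈)))
  U∘T : ∀ s n → SymsBelow n s → ∀ n' → IdxBelow n' (T n s) → U n' (T n s) =α s
  U∘T s n syms n' idxs = Un-Tr s [] [] [] [] (X n) (X n) (X n') (X n') onFv onFm
    where
    onFv : All (Agrees [] [] (X n) (X n')) (fv s)
    onFv = All-tabulate λ {x} x∈ → let x<n = All-lookup syms (∈-++⁺ˡ x∈) in
      agrees-X n n' x<n (proj₁ (All-lookup idxs (∈-++⁺ˡ (idx-∈-fvdB-Tr s (X n) (X n) x∈ (locate-X n x x<n)))))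
    onFm : All (Agrees [] [] (X n) (X n')) (fm s)
    onFm = All-tabulate λ {x} x∈ → let x<n = All-lookup syms (∈-++⁺ʳ (fv s) x∈) in
      agrees-X n n' x<n (proj₁ (All-lookup idxs (∈-++⁺ʳ (fvdB (T n s)) (idx-∈-fmdB-Tr s (X n) (X n) x∈ (locate-X n x x<n)))))
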